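{- Let $f$ be a monotone read-once function computed by a read-once formula that contains at least two variables. Then at least one of the following holds: (1) there is a maxterm $T$ of $f$ and a partition of $T$ into two sets $T_1,T_2$ such that $\mathrm{cs}(f_{T_1=0})=\mathrm{cs}(f_{T_2=0})=\mathrm{cs}(f)$; (2) there is a minterm $S$ of $f$ and a partition of $S$ into two sets $S_1,S_2$ such that $\mathrm{ds}(f_{S_1=1})=\mathrm{ds}(f_{S_2=1})=\mathrm{ds}(f)$.
   Context: A read-once formula is a Boolean formula over AND and OR gates (each gate having at least two inputs) whose leaves are distinct variables, possibly negated; it is monotone if no variable is negated. A read-once function is a Boolean function computed by a read-once formula. For a monotone Boolean function $f$, a maxterm is a set $S$ of variables such that setting the variables in $S$ to $0$ forces $f$ to $0$ but this holds for no proper subset of $S$; a minterm is a set $S$ such that setting the variables of $S$ to $1$ forces $f$ to $1$, but this holds for no proper subset. For a set $T$ of variables, $f_{T=0}$ (resp. $f_{T=1}$) is the function induced from $f$ by setting all variables of $T$ to $0$ (resp. $1$). $\mathrm{ds}(h)$ is the minimum number of terms in a DNF formula for $h$, and $\mathrm{cs}(h)$ the minimum number of clauses in a CNF formula for $h$. -}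

module Defs where

open import Data.Nat using (ℕ; _≤_)
open import Data.Bool using (Bool; true; false; if_then_else_; _∧_; _∨_; not)
open import Data.Fin using (Fin)
open import Data.Fin.Subset using (Subset; _⊂_; _∪_; _∩_; Nonempty; Empty)
open import Data.Vec using (lookup)
open import Data.List using (List; []; _∷_; _++_; length; map; foldr)
open import Data.List.Relation.Unary.Unique.Propositional using (Unique)
open import Data.Product using (_×_; ∃; Σ)
open import Relation.Binary.PropositionalEquality using (_≡_)
open import Relation.Nullary using (¬_)

BoolFun : ℕ → Set
BoolFun n = (Fin n → Bool) → Bool

-- Monotone formulas over AND / OR gates (binary gates; a gate with k ≥ 2
-- inputs is an iterated binary gate, so the class of computed functions is
-- the same).  Leaves are un-negated variables.
data MFormula (n : ℕ) : Set where
  var  : Fin n → MFormula n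
  and′ : MFormula n → MFormula n → MFormula n
  or′  : MFormula n → MFormula n → MFormula n

vars : ∀ {n} → MFormula n → List (Fin n)
vars (var i)    = i ∷ []
vars (and′ F G) = vars F ++ vars G
vars (or′ F G)  = vars F ++ vars G

evalF : ∀ {n} → MFormula n → BoolFun n
evalF (var i)    x = x i
evalF (and′ F G) x = evalF F x ∧ evalF G x
evalF (or′ F G)  x = evalF F x ∨ evalF G x

ReadOnce : ∀ {n} → MFormula n → Set
ReadOnce F = Unique (vars F)

set0 : ∀ {n} → Subset n → (Fin n → Bool) → (Fin n → Bool)
set0 T x i = if lookup T i then false else x i

set1 : ∀ {n} → Subset n → (Fin n → Bool) → (Fin n → Bool)
set1 T x i = if lookup T i then true else x i

restrict0 : ∀ {n} → BoolFun n → Subset n → BoolFun n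
restrict0 f T x = f (set0 T x)

restrict1 : ∀ {n} → BoolFun n → Subset n → BoolFun n
restrict1 f T x = f (set1 T x)

Forces0 : ∀ {n} → BoolFun n → Subset n → Set
Forces0 f S = ∀ x → f (set0 S x) ≡ false

Forces1 : ∀ {n} → BoolFun n → Subset n → Set
Forces1 f S = ∀ x → f (set1 S x) ≡ true

IsMaxterm : ∀ {n} → BoolFun n → Subset n → Set
IsMaxterm f S = Forces0 f S × (∀ S′ → S′ ⊂ S → ¬ Forces0 f S′)

IsMinterm : ∀ {n} → BoolFun n → Subset n → Set
IsMinterm f S = Forces1 f S × (∀ S′ → S′ ⊂ S → ¬ Forces1 f S′)

IsPartition2 : ∀ {n} → Subset n → Subset n → Subset n → Set
IsPartition2 T T₁ T₂ =
  (T₁ ∪ T₂ ≡ T) × Empty (T₁ ∩ T₂) × Nonempty T₁ × Nonempty T₂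

Literal : ℕ → Set
Literal n = Σ (Fin n) (λ _ → Bool)

evalLit : ∀ {n} → Literal n → (Fin n → Bool) → Bool
evalLit (i Data.Product., true)  x = x i
evalLit (i Data.Product., false) x = not (x i)

DNF : ℕ → Set
DNF n = List (List (Literal n))

CNF : ℕ → Set
CNF n = List (List (Literal n))

evalDNF : ∀ {n} → DNF n → BoolFun n
evalDNF D x = foldr (λ t acc → foldr (λ l a → evalLit l x ∧ a) true t ∨ acc) false D

evalCNF : ∀ {n} → CNF n → BoolFun n
evalCNF C x = foldr (λ c acc → foldr (λ l a → evalLit l x ∨ a) false c ∧ acc) true C

DNFfor : ∀ {n} → BoolFun n → DNF n → Set
DNFfor h D = ∀ x → evalDNF D x ≡ h x

CNFfor : ∀ {n} → BoolFun n → CNF n → Set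
CNFfor h C = ∀ x → evalCNF C x ≡ h x

IsDS : ∀ {n} → BoolFun n → ℕ → Set
IsDS h k = (∃ λ D → DNFfor h D × length D ≡ k) × (∀ D → DNFfor h D → k ≤ length D)

IsCS : ∀ {n} → BoolFun n → ℕ → Set
IsCS h k = (∃ λ C → CNFfor h C × length C ≡ k) × (∀ C → CNFfor h C → k ≤ length C)

-- ds(h) = k is certified by a DNF with k terms together with k pairwise incomparable
-- minterms of h: no term can cover two of them, since it would then cover their meet.
-- Over disjoint supports such certificates multiply under ∧ and add under ∨.  Call a
-- minterm p₁ ⊔ p₂ of f split if ds(f) = ds(f_{p₁=1}) = ds(f_{p₂=1}).  Splits of g and h
-- combine crosswise into a proper split of g ∧ h, and a proper split of g remains one
-- of g ∨ h.  Inducting on a read-once formula F and its dual simultaneously yields a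
-- proper split of F or of dual F; since dual F computes ¬F(¬x), a DNF for it is a CNF
-- for F, which turns the latter into the maxterm alternative.

module Submission where

open import Defs
open import Algebra.Bundles using (CommutativeMonoid)
open import Data.Bool using (Bool; true; false; if_then_else_; _∧_; _∨_; not)
open import Data.Bool.Properties
  using (∨-identityʳ; ∨-zeroʳ; ∨-comm; ∧-identityʳ; ∧-zeroʳ; ∧-distribʳ-∨; not-involutive;
         ∨-commutativeMonoid; ∨-∧-booleanAlgebra)
open import Algebra.Properties.CommutativeSemigroup (CommutativeMonoid.commutativeSemigroup ∨-commutativeMonoid)
  using (interchange)
open import Algebra.Lattice.Properties.BooleanAlgebra ∨-∧-booleanAlgebra using (deMorgan₁; deMorgan₂)
open import Data.Empty using (⊥; ⊥-elim)
open import Data.Fin using (Fin; zero; suc; remQuot; combine; splitAt; join)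
open import Data.Fin.Properties using (injective⇒≤; combine-remQuot; join-splitAt; _≟_)
open import Data.Fin.Subset using (Subset; _⊂_; _∪_; _∩_; Empty) renaming (_∈_ to _∈ₛ_)
open import Data.List using (List; []; _∷_; _++_; length; map; foldr; cartesianProductWith)
import Data.List as List
open import Data.List.Properties using (length-++; length-map)
open import Data.List.Membership.Propositional using (_∈_)
open import Data.List.Membership.Propositional.Properties using (∈-++⁺ˡ; ∈-++⁺ʳ)
import Data.List.Relation.Unary.All as All
open import Data.List.Relation.Unary.All.Properties using (++⁻ˡ; ++⁻ʳ)
open import Data.List.Relation.Unary.AllPairs using ([]; _∷_)
open import Data.List.Relation.Unary.Any using (here; there)
open import Data.List.Relation.Unary.Unique.Propositional using (Unique)
open import Data.Nat using (ℕ; _≤_; _+_; _*_; s≤s)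
open import Data.Product using (_×_; Σ; ∃; ∃₂; _,_; proj₁; proj₂; uncurry)
open import Data.Sum using (_⊎_; inj₁; inj₂; [_,_]′)
open import Data.Vec using (lookup; tabulate)
open import Data.Vec.Properties using (lookup-zipWith; lookup∘tabulate; []=⇒lookup; lookup⇒[]=)
open import Function using (_∘_)
open import Relation.Nullary using (¬_; yes; does)
open import Relation.Nullary.Decidable using (dec-true)
open import Relation.Binary.PropositionalEquality
  using (_≡_; refl; sym; trans; cong; cong₂; subst; _≗_; module ≡-Reasoning)

private variable n : ℕ

∨≡true⇒ : ∀ a b → a ∨ b ≡ true → a ≡ true ⊎ b ≡ true
∨≡true⇒ true  _ _ = inj₁ refl
∨≡true⇒ false _ e = inj₂ e

∧≡true⇒ : ∀ a b → a ∧ b ≡ true → a ≡ true × b ≡ true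
∧≡true⇒ true true _ = refl , refl

true≢false : ∀ {b} → b ≡ true → b ≡ false → ⊥
true≢false refl ()

contraposeᵇ : ∀ {a b} → (a ≡ true → b ≡ false) → b ≡ true → a ≡ false
contraposeᵇ {false} _ _ = refl
contraposeᵇ {true}  f e = ⊥-elim (true≢false e (f refl))

-- Assignments and minimal true points

-- An assignment doubles as the set of variables it makes true; raise p x sets the
-- variables of p to 1, like set1.
Point : ℕ → Set
Point n = Fin n → Bool

infix  4 _⊑_
infixl 6 _⊔_

_⊑_ : Point n → Point n → Set
p ⊑ q = ∀ i → p i ≡ true → q i ≡ true

_⊔_ : Point n → Point n → Point n
(p ⊔ q) i = p i ∨ q i

0ₚ : Point n
0ₚ _ = false

raise : Point n → Point n → Point n
raise p x i = if p i then true else x i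

Extensional : BoolFun n → Set
Extensional f = ∀ {x y} → (∀ i → x i ≡ y i) → f x ≡ f y

Monotone : BoolFun n → Set
Monotone f = ∀ {x y} → x ⊑ y → f x ≡ true → f y ≡ true

Disjoint : Point n → Point n → Set
Disjoint A B = ∀ i → A i ≡ true → B i ≡ false

DependsOn : BoolFun n → Point n → Set
DependsOn h A = ∀ x y → (∀ i → A i ≡ true → x i ≡ y i) → h x ≡ h y

IsMinimalTrue : BoolFun n → Point n → Set
IsMinimalTrue h p = h p ≡ true × (∀ q → q ⊑ p → h q ≡ true → p ⊑ q)

dependsOn⇒extensional : ∀ {h : BoolFun n} {A} → DependsOn h A → Extensional h
dependsOn⇒extensional dep {x} {y} x≗y = dep x y (λ i _ → x≗y i)

disjoint-sym : ∀ {A B : Point n} → Disjoint A B → Disjoint B A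
disjoint-sym {A = A} A#B i Bi with A i in Ai
... | false = refl
... | true  = ⊥-elim (true≢false Bi (A#B i Ai))

⊑-disjoint⇒false : ∀ {q A B : Point n} → q ⊑ B → Disjoint A B → ∀ i → A i ≡ true → q i ≡ false
⊑-disjoint⇒false {q = q} q⊑B A#B i Ai with q i in qi
... | false = refl
... | true  = ⊥-elim (true≢false (q⊑B i qi) (A#B i Ai))

⊔-on-left : ∀ {p q A B : Point n} → q ⊑ B → Disjoint A B → ∀ i → A i ≡ true → (p ⊔ q) i ≡ p i
⊔-on-left {p = p} {q} q⊑B A#B i Ai rewrite ⊑-disjoint⇒false {q = q} q⊑B A#B i Ai = ∨-identityʳ (p i)

⊔-on-right : ∀ {p q A B : Point n} → p ⊑ A → Disjoint A B → ∀ i → B i ≡ true → (p ⊔ q) i ≡ q i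
⊔-on-right {p = p} {q} p⊑A A#B i Bi = trans (∨-comm (p i) (q i)) (⊔-on-left {p = q} p⊑A (disjoint-sym A#B) i Bi)

⊑-⊔ˡ : ∀ {p A B : Point n} → p ⊑ A → p ⊑ A ⊔ B
⊑-⊔ˡ {B = B} p⊑A i pi = cong (_∨ B i) (p⊑A i pi)

⊑-⊔ʳ : ∀ {p A B : Point n} → p ⊑ B → p ⊑ A ⊔ B
⊑-⊔ʳ {A = A} p⊑B i pi = trans (cong (A i ∨_) (p⊑B i pi)) (∨-zeroʳ (A i))

⊔-upperˡ : (A B : Point n) → A ⊑ A ⊔ B
⊔-upperˡ A B = ⊑-⊔ˡ {B = B} (λ _ a → a)

⊔-upperʳ : (A B : Point n) → B ⊑ A ⊔ B
⊔-upperʳ A B = ⊑-⊔ʳ {A = A} (λ _ b → b)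

⊔-lub : ∀ {p q C : Point n} → p ⊑ C → q ⊑ C → p ⊔ q ⊑ C
⊔-lub {p = p} {q} p⊑C q⊑C i e = [ p⊑C i , q⊑C i ]′ (∨≡true⇒ (p i) (q i) e)

⊑-⊔-onˡ : ∀ {r p q A B : Point n} → q ⊑ B → Disjoint A B → r ⊑ p ⊔ q →
          ∀ i → A i ≡ true → r i ≡ true → p i ≡ true
⊑-⊔-onˡ {p = p} {q} q⊑B A#B r⊑p⊔q i Ai ri with ∨≡true⇒ (p i) (q i) (r⊑p⊔q i ri)
... | inj₁ pi = pi
... | inj₂ qi = ⊥-elim (true≢false (q⊑B i qi) (A#B i Ai))

⊑-⊔-onʳ : ∀ {r p q A B : Point n} → p ⊑ A → Disjoint A B → r ⊑ p ⊔ q →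
          ∀ i → B i ≡ true → r i ≡ true → q i ≡ true
⊑-⊔-onʳ {p = p} {q} p⊑A A#B r⊑p⊔q i Bi ri with ∨≡true⇒ (p i) (q i) (r⊑p⊔q i ri)
... | inj₂ qi = qi
... | inj₁ pi = ⊥-elim (true≢false (p⊑A i pi) (disjoint-sym A#B i Bi))

⊔-cancelˡ : ∀ {p q p′ q′ A B : Point n} → p ⊑ A → q′ ⊑ B → Disjoint A B → p ⊔ q ⊑ p′ ⊔ q′ → p ⊑ p′
⊔-cancelˡ {p = p} {q} p⊑A q′⊑B A#B le i pi =
  ⊑-⊔-onˡ q′⊑B A#B (λ j pj → le j (⊔-upperˡ p q j pj)) i (p⊑A i pi) pi

⊔-cancelʳ : ∀ {p q p′ q′ A B : Point n} → q ⊑ B → p′ ⊑ A → Disjoint A B → p ⊔ q ⊑ p′ ⊔ q′ → q ⊑ q′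
⊔-cancelʳ {p = p} {q} q⊑B p′⊑A A#B le i qi =
  ⊑-⊔-onʳ p′⊑A A#B (λ j qj → le j (⊔-upperʳ p q j qj)) i (q⊑B i qi) qi

dependsOn-raise : ∀ {h : BoolFun n} {A p p′} → DependsOn h A → (∀ i → A i ≡ true → p i ≡ p′ i) →
                  ∀ x → h (raise p x) ≡ h (raise p′ x)
dependsOn-raise dep p≡p′ x = dep _ _ (λ i Ai → cong (λ b → if b then true else x i) (p≡p′ i Ai))

raise-off : ∀ (p x : Point n) i → p i ≡ false → raise p x i ≡ x i
raise-off p x i pi rewrite pi = refl

false-off-support : ∀ {h : BoolFun n} {B r} → DependsOn h B → (∀ i → B i ≡ true → r i ≡ false) →
                    h 0ₚ ≡ false → h r ≡ false
false-off-support dep r-off h0 = trans (dep _ 0ₚ r-off) h0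

below-minimal⇒false : ∀ {f : BoolFun n} {p q} → IsMinimalTrue f p → q ⊑ p →
                      ∀ i → p i ≡ true → q i ≡ false → f q ≡ false
below-minimal⇒false {f = f} {p} {q} (_ , min) q⊑p i pi qi with f q in fq
... | false = refl
... | true  = ⊥-elim (true≢false (min q q⊑p fq i pi) qi)

minimalTrue-cong : ∀ {f : BoolFun n} {p p′} → Extensional f → (∀ i → p i ≡ p′ i) →
                   IsMinimalTrue f p → IsMinimalTrue f p′
minimalTrue-cong ext p≗p′ (fp , min) =
  trans (ext (λ i → sym (p≗p′ i))) fp ,
  λ q q⊑p′ fq i p′i → min q (λ j qj → trans (p≗p′ j) (q⊑p′ j qj)) fq i (trans (p≗p′ i) p′i)

-- Intersecting r with A keeps g true, and then minimality of p applies.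
minimalTrue-⊑ : ∀ {g : BoolFun n} {A p r} → DependsOn g A → IsMinimalTrue g p → g r ≡ true →
                (∀ i → A i ≡ true → r i ≡ true → p i ≡ true) → p ⊑ r
minimalTrue-⊑ {g = g} {A} {p} {r} dep (_ , min) gr r∩A⊑p i pi =
  proj₂ (∧≡true⇒ (A i) (r i) (min r∩A r∩A⊑p′ g[r∩A] i pi))
  where
  r∩A : Point _
  r∩A i = A i ∧ r i
  r∩A⊑p′ : r∩A ⊑ p
  r∩A⊑p′ i e = let (Ai , ri) = ∧≡true⇒ (A i) (r i) e in r∩A⊑p i Ai ri
  g[r∩A] : g r∩A ≡ true
  g[r∩A] = trans (dep r∩A r (λ i Ai → cong (_∧ r i) Ai)) gr

∧-minimalTrue : ∀ {g h : BoolFun n} {A B p q} → DependsOn g A → DependsOn h B → Disjoint A B →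
                IsMinimalTrue g p → IsMinimalTrue h q → p ⊑ A → q ⊑ B → IsMinimalTrue (λ x → g x ∧ h x) (p ⊔ q)
∧-minimalTrue {g = g} {h} {A} {B} {p} {q} depg deph A#B mg mh p⊑A q⊑B = true-at-p⊔q , minimal
  where
  g[p⊔q] : g (p ⊔ q) ≡ true
  g[p⊔q] = trans (depg (p ⊔ q) p (⊔-on-left {p = p} q⊑B A#B)) (proj₁ mg)
  h[p⊔q] : h (p ⊔ q) ≡ true
  h[p⊔q] = trans (deph (p ⊔ q) q (⊔-on-right {p = p} p⊑A A#B)) (proj₁ mh)
  true-at-p⊔q : g (p ⊔ q) ∧ h (p ⊔ q) ≡ true
  true-at-p⊔q rewrite g[p⊔q] | h[p⊔q] = refl
  minimal : ∀ r → r ⊑ p ⊔ q → g r ∧ h r ≡ true → p ⊔ q ⊑ r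
  minimal r r⊑p⊔q ghr i e with ∧≡true⇒ (g r) (h r) ghr | ∨≡true⇒ (p i) (q i) e
  ... | gr , _ | inj₁ pi = minimalTrue-⊑ depg mg gr (⊑-⊔-onˡ q⊑B A#B r⊑p⊔q) i pi
  ... | _ , hr | inj₂ qi = minimalTrue-⊑ deph mh hr (⊑-⊔-onʳ p⊑A A#B r⊑p⊔q) i qi

∨-minimalTrueˡ : ∀ {g h : BoolFun n} {A B p} → DependsOn h B → Disjoint A B → h 0ₚ ≡ false →
                 IsMinimalTrue g p → p ⊑ A → IsMinimalTrue (λ x → g x ∨ h x) p
∨-minimalTrueˡ {g = g} {h} {p = p} deph A#B h0 (gp , min) p⊑A = true-at-p , minimal
  where
  true-at-p : g p ∨ h p ≡ true
  true-at-p rewrite gp = refl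
  minimal : ∀ r → r ⊑ p → g r ∨ h r ≡ true → p ⊑ r
  minimal r r⊑p ghr with ∨≡true⇒ (g r) (h r) ghr
  ... | inj₁ gr = min r r⊑p gr
  ... | inj₂ hr = ⊥-elim (true≢false hr
    (false-off-support deph (⊑-disjoint⇒false (λ i ri → p⊑A i (r⊑p i ri)) (disjoint-sym A#B)) h0))

∨-minimalTrueʳ : ∀ {g h : BoolFun n} {A B q} → DependsOn g A → Disjoint A B → g 0ₚ ≡ false →
                 IsMinimalTrue h q → q ⊑ B → IsMinimalTrue (λ x → g x ∨ h x) q
∨-minimalTrueʳ {g = g} {h} {q = q} depg A#B g0 (hq , min) q⊑B = true-at-q , minimal
  where
  true-at-q : g q ∨ h q ≡ true
  true-at-q rewrite hq = ∨-zeroʳ (g q)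
  minimal : ∀ r → r ⊑ q → g r ∨ h r ≡ true → q ⊑ r
  minimal r r⊑q ghr with ∨≡true⇒ (g r) (h r) ghr
  ... | inj₂ hr = min r r⊑q hr
  ... | inj₁ gr = ⊥-elim (true≢false gr
    (false-off-support depg (⊑-disjoint⇒false (λ i ri → q⊑B i (r⊑q i ri)) A#B) g0))

-- Certificates for ds

evalTerm : List (Literal n) → Point n → Bool
evalTerm t x = foldr (λ l a → evalLit l x ∧ a) true t

evalDNF-true⇒term : (D : DNF n) (x : Point n) → evalDNF D x ≡ true →
                    Σ (Fin (length D)) λ c → evalTerm (List.lookup D c) x ≡ true
evalDNF-true⇒term (t ∷ D) x e with ∨≡true⇒ (evalTerm t x) (evalDNF D x) e
... | inj₁ tx = zero , tx
... | inj₂ Dx = let (c , tx) = evalDNF-true⇒term D x Dx in suc c , tx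

term-true⇒evalDNF : (D : DNF n) (c : Fin (length D)) (x : Point n) → evalTerm (List.lookup D c) x ≡ true → evalDNF D x ≡ true
term-true⇒evalDNF (t ∷ D) zero    x e rewrite e = refl
term-true⇒evalDNF (t ∷ D) (suc c) x e rewrite term-true⇒evalDNF D c x e = ∨-zeroʳ (evalTerm t x)

_⊓_ : Point n → Point n → Point n
(x ⊓ y) i = x i ∧ y i

evalLit-⊓ : (l : Literal n) (x y : Point n) → evalLit l x ≡ true → evalLit l y ≡ true → evalLit l (x ⊓ y) ≡ true
evalLit-⊓ (i , true)  x y ex ey rewrite ex | ey = refl
evalLit-⊓ (i , false) x y ex ey with x i
... | false = refl

evalTerm-⊓ : (t : List (Literal n)) (x y : Point n) → evalTerm t x ≡ true → evalTerm t y ≡ true → evalTerm t (x ⊓ y) ≡ true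
evalTerm-⊓ []      x y _  _  = refl
evalTerm-⊓ (l ∷ t) x y ex ey with ∧≡true⇒ (evalLit l x) _ ex | ∧≡true⇒ (evalLit l y) _ ey
... | lx , tx | ly , ty rewrite evalLit-⊓ l x y lx ly = evalTerm-⊓ t x y tx ty

record DsCertificate (h : BoolFun n) (A : Point n) (k : ℕ) : Set where
  field
    dnf         : DNF n
    length-dnf  : length dnf ≡ k
    correct     : DNFfor h dnf
    minterm     : Fin k → Point n
    minimal     : ∀ c → IsMinimalTrue h (minterm c)
    antichain   : ∀ c c′ → minterm c ⊑ minterm c′ → c ≡ c′
    minterm⊑A   : ∀ c → minterm c ⊑ A
    dependsOn-A : DependsOn h A

module _ {h : BoolFun n} {A : Point n} {k : ℕ} (C : DsCertificate h A k) where
  open DsCertificate C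

  -- Two minterms satisfying the same term force its value at their meet, so the
  -- term assignment is injective.
  ds-lowerBound : ∀ D → DNFfor h D → k ≤ length D
  ds-lowerBound D D-correct = injective⇒≤ {f = term} term-injective
    where
    covering : ∀ c → Σ (Fin (length D)) λ t → evalTerm (List.lookup D t) (minterm c) ≡ true
    covering c = evalDNF-true⇒term D (minterm c) (trans (D-correct (minterm c)) (proj₁ (minimal c)))
    term : Fin k → Fin (length D)
    term c = proj₁ (covering c)
    term-injective : ∀ {c c′} → term c ≡ term c′ → c ≡ c′
    term-injective {c} {c′} eq = antichain c c′ mc⊑mc′
      where
      h-meet : h (minterm c ⊓ minterm c′) ≡ true
      h-meet = trans (sym (D-correct _)) (term-true⇒evalDNF D (term c) _
        (evalTerm-⊓ (List.lookup D (term c)) _ _ (proj₂ (covering c))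
          (subst (λ t → evalTerm (List.lookup D t) (minterm c′) ≡ true) (sym eq) (proj₂ (covering c′)))))
      mc⊑mc′ : minterm c ⊑ minterm c′
      mc⊑mc′ i mi = proj₂ (∧≡true⇒ (minterm c i) _
        (proj₂ (minimal c) _ (λ j e → proj₁ (∧≡true⇒ _ _ e)) h-meet i mi))

  isDS : IsDS h k
  isDS = (dnf , correct , length-dnf) , ds-lowerBound

DsCertificate-resp : ∀ {h h′ : BoolFun n} {A k} → h ≗ h′ → DsCertificate h A k → DsCertificate h′ A k
DsCertificate-resp h≗h′ C = record
  { dnf = dnf ; length-dnf = length-dnf ; correct = λ x → trans (correct x) (h≗h′ x)
  ; minterm = minterm
  ; minimal = λ c → trans (sym (h≗h′ _)) (proj₁ (minimal c))
                  , λ q q⊑ h′q → proj₂ (minimal c) q q⊑ (trans (h≗h′ q) h′q)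
  ; antichain = antichain ; minterm⊑A = minterm⊑A
  ; dependsOn-A = λ x y e → trans (sym (h≗h′ x)) (trans (dependsOn-A x y e) (h≗h′ y)) }
  where open DsCertificate C

only : Fin n → Point n
only i j = does (i ≟ j)

only-self : (i : Fin n) → only i i ≡ true
only-self i = dec-true (i ≟ i) refl

only-true⇒≡ : (i j : Fin n) → only i j ≡ true → i ≡ j
only-true⇒≡ i j e with i ≟ j
... | yes i≡j = i≡j

var-DsCertificate : (i : Fin n) → DsCertificate (λ x → x i) (only i) 1
var-DsCertificate i = record
  { dnf = ((i , true) ∷ []) ∷ [] ; length-dnf = refl
  ; correct = λ x → trans (∨-identityʳ _) (∧-identityʳ (x i))
  ; minterm = λ _ → only i
  ; minimal = λ _ → only-self i , λ q _ qi j e → subst (λ j → q j ≡ true) (only-true⇒≡ i j e) qi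
  ; antichain = λ { zero zero _ → refl } ; minterm⊑A = λ _ _ e → e
  ; dependsOn-A = λ x y e → e i (only-self i) }

true-DsCertificate : (A : Point n) → DsCertificate (λ _ → true) A 1
true-DsCertificate A = record
  { dnf = [] ∷ [] ; length-dnf = refl ; correct = λ _ → refl
  ; minterm = λ _ → 0ₚ
  ; minimal = λ _ → refl , λ _ _ _ _ ()
  ; antichain = λ { zero zero _ → refl } ; minterm⊑A = λ _ _ ()
  ; dependsOn-A = λ _ _ _ → refl }

evalTerm-++ : (t u : List (Literal n)) (x : Point n) → evalTerm (t ++ u) x ≡ evalTerm t x ∧ evalTerm u x
evalTerm-++ []      u x = refl
evalTerm-++ (l ∷ t) u x with evalLit l x
... | true  = evalTerm-++ t u x
... | false = refl

evalDNF-++ : (D E : DNF n) (x : Point n) → evalDNF (D ++ E) x ≡ evalDNF D x ∨ evalDNF E x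
evalDNF-++ []      E x = refl
evalDNF-++ (t ∷ D) E x with evalTerm t x
... | true  = refl
... | false = evalDNF-++ D E x

evalDNF-map-++ : (t : List (Literal n)) (E : DNF n) (x : Point n) → evalDNF (map (t ++_) E) x ≡ evalTerm t x ∧ evalDNF E x
evalDNF-map-++ t []      x = sym (∧-zeroʳ (evalTerm t x))
evalDNF-map-++ t (u ∷ E) x rewrite evalTerm-++ t u x | evalDNF-map-++ t E x with evalTerm t x
... | true  = refl
... | false = refl

_⊗_ : DNF n → DNF n → DNF n
_⊗_ = cartesianProductWith _++_

evalDNF-⊗ : (D E : DNF n) (x : Point n) → evalDNF (D ⊗ E) x ≡ evalDNF D x ∧ evalDNF E x
evalDNF-⊗ []      E x = refl
evalDNF-⊗ (t ∷ D) E x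
  rewrite evalDNF-++ (map (t ++_) E) (D ⊗ E) x | evalDNF-map-++ t E x | evalDNF-⊗ D E x =
  sym (∧-distribʳ-∨ (evalDNF E x) (evalTerm t x) (evalDNF D x))

length-⊗ : (D E : DNF n) → length (D ⊗ E) ≡ length D * length E
length-⊗ []      E = refl
length-⊗ (t ∷ D) E = trans (length-++ (map (t ++_) E)) (cong₂ _+_ (length-map (t ++_) E) (length-⊗ D E))

dependsOn-∧ : ∀ {g h : BoolFun n} {A B} → DependsOn g A → DependsOn h B → DependsOn (λ x → g x ∧ h x) (A ⊔ B)
dependsOn-∧ {A = A} {B} depg deph x y e =
  cong₂ _∧_ (depg x y (λ i Ai → e i (⊔-upperˡ A B i Ai))) (deph x y (λ i Bi → e i (⊔-upperʳ A B i Bi)))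

dependsOn-∨ : ∀ {g h : BoolFun n} {A B} → DependsOn g A → DependsOn h B → DependsOn (λ x → g x ∨ h x) (A ⊔ B)
dependsOn-∨ {A = A} {B} depg deph x y e =
  cong₂ _∨_ (depg x y (λ i Ai → e i (⊔-upperˡ A B i Ai))) (deph x y (λ i Bi → e i (⊔-upperʳ A B i Bi)))

-- The minterms of g ∧ h are the unions of a minterm of g and one of h.
∧-DsCertificate : ∀ {g h : BoolFun n} {A B a b} → Disjoint A B →
                  DsCertificate g A a → DsCertificate h B b → DsCertificate (λ x → g x ∧ h x) (A ⊔ B) (a * b)
∧-DsCertificate {n = n} {A = A} {B} {a} {b} A#B Cg Ch = record
  { dnf = G.dnf ⊗ H.dnf
  ; length-dnf = trans (length-⊗ G.dnf H.dnf) (cong₂ _*_ G.length-dnf H.length-dnf)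
  ; correct = λ x → trans (evalDNF-⊗ G.dnf H.dnf x) (cong₂ _∧_ (G.correct x) (H.correct x))
  ; minterm = minterm
  ; minimal = λ c → ∧-minimalTrue G.dependsOn-A H.dependsOn-A A#B (G.minimal (left c)) (H.minimal (right c))
                                  (G.minterm⊑A (left c)) (H.minterm⊑A (right c))
  ; antichain = antichain
  ; minterm⊑A = λ c → ⊔-lub (⊑-⊔ˡ {B = B} (G.minterm⊑A (left c))) (⊑-⊔ʳ {A = A} (H.minterm⊑A (right c)))
  ; dependsOn-A = dependsOn-∧ G.dependsOn-A H.dependsOn-A
  }
  where
  module G = DsCertificate Cg
  module H = DsCertificate Ch
  left : Fin (a * b) → Fin a
  left c = proj₁ (remQuot {a} b c)
  right : Fin (a * b) → Fin b
  right c = proj₂ (remQuot {a} b c)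
  minterm : Fin (a * b) → Point n
  minterm c = G.minterm (left c) ⊔ H.minterm (right c)
  antichain : ∀ c c′ → minterm c ⊑ minterm c′ → c ≡ c′
  antichain c c′ le = begin
    c                                  ≡⟨ combine-remQuot {a} b c ⟨
    uncurry combine (remQuot {a} b c)  ≡⟨ cong (uncurry combine) (cong₂ _,_ same-left same-right) ⟩
    uncurry combine (remQuot {a} b c′) ≡⟨ combine-remQuot {a} b c′ ⟩
    c′                                 ∎
    where
    open ≡-Reasoning
    same-left : left c ≡ left c′
    same-left = G.antichain _ _ (⊔-cancelˡ (G.minterm⊑A (left c)) (H.minterm⊑A (right c′)) A#B le)
    same-right : right c ≡ right c′
    same-right = H.antichain _ _ (⊔-cancelʳ (H.minterm⊑A (right c)) (G.minterm⊑A (left c′)) A#B le)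

-- Since g 0 = h 0 = false and the supports are disjoint, no minterm of g is
-- comparable with a minterm of h; so the minterms of g ∨ h are those of g and of h.
∨-DsCertificate : ∀ {g h : BoolFun n} {A B a b} → Disjoint A B → g 0ₚ ≡ false → h 0ₚ ≡ false →
                  DsCertificate g A a → DsCertificate h B b → DsCertificate (λ x → g x ∨ h x) (A ⊔ B) (a + b)
∨-DsCertificate {n = n} {A = A} {B} {a} {b} A#B g0 h0 Cg Ch = record
  { dnf = G.dnf ++ H.dnf
  ; length-dnf = trans (length-++ G.dnf) (cong₂ _+_ G.length-dnf H.length-dnf)
  ; correct = λ x → trans (evalDNF-++ G.dnf H.dnf x) (cong₂ _∨_ (G.correct x) (H.correct x))
  ; minterm = minterm
  ; minimal = minimal
  ; antichain = antichain
  ; minterm⊑A = minterm⊑A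
  ; dependsOn-A = dependsOn-∨ G.dependsOn-A H.dependsOn-A
  }
  where
  module G = DsCertificate Cg
  module H = DsCertificate Ch
  minterm : Fin (a + b) → Point n
  minterm c = [ G.minterm , H.minterm ]′ (splitAt a c)
  minimal : ∀ c → IsMinimalTrue _ (minterm c)
  minimal c with splitAt a c
  ... | inj₁ i = ∨-minimalTrueˡ H.dependsOn-A A#B h0 (G.minimal i) (G.minterm⊑A i)
  ... | inj₂ j = ∨-minimalTrueʳ G.dependsOn-A A#B g0 (H.minimal j) (H.minterm⊑A j)
  minterm⊑A : ∀ c → minterm c ⊑ A ⊔ B
  minterm⊑A c with splitAt a c
  ... | inj₁ i = ⊑-⊔ˡ {B = B} (G.minterm⊑A i)
  ... | inj₂ j = ⊑-⊔ʳ {A = A} (H.minterm⊑A j)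
  g⋢h : ∀ i j → G.minterm i ⊑ H.minterm j → ⊥
  g⋢h i j le = true≢false (proj₁ (G.minimal i))
    (false-off-support G.dependsOn-A (⊑-disjoint⇒false (λ v e → H.minterm⊑A j v (le v e)) A#B) g0)
  h⋢g : ∀ i j → H.minterm j ⊑ G.minterm i → ⊥
  h⋢g i j le = true≢false (proj₁ (H.minimal j))
    (false-off-support H.dependsOn-A (⊑-disjoint⇒false (λ v e → G.minterm⊑A i v (le v e)) (disjoint-sym A#B)) h0)
  join-of : ∀ c {s} → splitAt a c ≡ s → c ≡ join a b s
  join-of c eq = trans (sym (join-splitAt a b c)) (cong (join a b) eq)
  antichain : ∀ c c′ → minterm c ⊑ minterm c′ → c ≡ c′
  antichain c c′ le with splitAt a c in e | splitAt a c′ in e′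
  ... | inj₁ i | inj₁ i′ = trans (join-of c e) (trans (cong (join a b ∘ inj₁) (G.antichain i i′ le)) (sym (join-of c′ e′)))
  ... | inj₂ j | inj₂ j′ = trans (join-of c e) (trans (cong (join a b ∘ inj₂) (H.antichain j j′ le)) (sym (join-of c′ e′)))
  ... | inj₁ i | inj₂ j′ = ⊥-elim (g⋢h i j′ le)
  ... | inj₂ j | inj₁ i′ = ⊥-elim (h⋢g i′ j le)

-- Split minterms

record SplitMinterm (f : BoolFun n) (A : Point n) : Set where
  field
    part₁ part₂     : Point n
    parts-disjoint  : Disjoint part₁ part₂
    minimal         : IsMinimalTrue f (part₁ ⊔ part₂)
    part₁-nonempty  : ∃ λ i → part₁ i ≡ true
    part₁⊑A         : part₁ ⊑ A
    part₂⊑A         : part₂ ⊑ A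
    ds              : ℕ
    certificate     : DsCertificate f A ds
    certificate₁    : DsCertificate (λ x → f (raise part₁ x)) A ds
    certificate₂    : DsCertificate (λ x → f (raise part₂ x)) A ds

  dependsOn-A : DependsOn f A
  dependsOn-A = DsCertificate.dependsOn-A certificate

ProperSplitMinterm : BoolFun n → Point n → Set
ProperSplitMinterm f A = Σ (SplitMinterm f A) λ s → ∃ λ i → SplitMinterm.part₂ s i ≡ true

module _ {f : BoolFun n} {A : Point n} (s : SplitMinterm f A) where
  open SplitMinterm s

  false-at-0ₚ : f 0ₚ ≡ false
  false-at-0ₚ = below-minimal⇒false minimal (λ _ ()) (proj₁ part₁-nonempty)
    (cong (_∨ part₂ (proj₁ part₁-nonempty)) (proj₂ part₁-nonempty)) refl

  false-at-part₁ : ∃ (λ i → part₂ i ≡ true) → f (raise part₁ 0ₚ) ≡ false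
  false-at-part₁ (i , p₂i) = below-minimal⇒false minimal below i
    (trans (cong (part₁ i ∨_) p₂i) (∨-zeroʳ (part₁ i))) (raise-off part₁ 0ₚ i (contraposeᵇ (parts-disjoint i) p₂i))
    where
    below : raise part₁ 0ₚ ⊑ part₁ ⊔ part₂
    below j e with part₁ j
    ... | true = refl

  false-at-part₂ : f (raise part₂ 0ₚ) ≡ false
  false-at-part₂ = below-minimal⇒false minimal below (proj₁ part₁-nonempty)
    (cong (_∨ part₂ _) (proj₂ part₁-nonempty)) (raise-off part₂ 0ₚ _ (parts-disjoint _ (proj₂ part₁-nonempty)))
    where
    below : raise part₂ 0ₚ ⊑ part₁ ⊔ part₂
    below j e with part₂ j
    ... | true = ∨-zeroʳ (part₁ j)

-- For a single variable x_i take p₁ = {i}, p₂ = ∅: then f_{p₁=1} = true and f_{p₂=1} = f.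
var-SplitMinterm : (i : Fin n) → SplitMinterm (λ x → x i) (only i)
var-SplitMinterm i = record
  { part₁ = only i ; part₂ = 0ₚ ; parts-disjoint = λ _ _ → refl
  ; minimal = subst (λ b → b ≡ true) (sym (∨-identityʳ (only i i))) (only-self i)
            , λ q _ qi j e → subst (λ j → q j ≡ true) (only-true⇒≡ i j (trans (sym (∨-identityʳ (only i j))) e)) qi
  ; part₁-nonempty = i , only-self i ; part₁⊑A = λ _ e → e ; part₂⊑A = λ _ ()
  ; ds = 1 ; certificate = var-DsCertificate i
  ; certificate₁ = DsCertificate-resp (λ x → sym (cong (λ b → if b then true else x i) (only-self i))) (true-DsCertificate _)
  ; certificate₂ = var-DsCertificate i }

-- Crosswise: (p₁ ⊔ q₂, p₂ ⊔ q₁) splits the minterm (p₁ ⊔ p₂) ⊔ (q₁ ⊔ q₂) of g ∧ h,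
-- and restricting either part gives a product of restrictions, ds(g) · ds(h) terms.
∧-SplitMinterm : ∀ {g h : BoolFun n} {A B} → Disjoint A B → SplitMinterm g A → SplitMinterm h B →
                 ProperSplitMinterm (λ x → g x ∧ h x) (A ⊔ B)
∧-SplitMinterm {n = n} {g} {h} {A} {B} A#B sg sh = record
  { part₁ = P₁ ; part₂ = P₂ ; parts-disjoint = P₁#P₂
  ; minimal = minimalTrue-cong (dependsOn⇒extensional (dependsOn-∧ G.dependsOn-A H.dependsOn-A))
      (λ i → trans (cong ((G.part₁ i ∨ G.part₂ i) ∨_) (∨-comm (H.part₁ i) (H.part₂ i)))
                   (interchange (G.part₁ i) (G.part₂ i) (H.part₂ i) (H.part₁ i)))
      (∧-minimalTrue G.dependsOn-A H.dependsOn-A A#B G.minimal H.minimal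
                     (⊔-lub G.part₁⊑A G.part₂⊑A) (⊔-lub H.part₁⊑A H.part₂⊑A))
  ; part₁-nonempty = proj₁ G.part₁-nonempty , cong (_∨ H.part₂ _) (proj₂ G.part₁-nonempty)
  ; part₁⊑A = ⊔-lub (⊑-⊔ˡ {B = B} G.part₁⊑A) (⊑-⊔ʳ {A = A} H.part₂⊑A)
  ; part₂⊑A = ⊔-lub (⊑-⊔ˡ {B = B} G.part₂⊑A) (⊑-⊔ʳ {A = A} H.part₁⊑A)
  ; ds = G.ds * H.ds
  ; certificate = ∧-DsCertificate A#B G.certificate H.certificate
  ; certificate₁ = DsCertificate-resp (raise-⊔ G.part₁⊑A H.part₂⊑A) (∧-DsCertificate A#B G.certificate₁ H.certificate₂)
  ; certificate₂ = DsCertificate-resp (raise-⊔ G.part₂⊑A H.part₁⊑A) (∧-DsCertificate A#B G.certificate₂ H.certificate₁)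
  } , proj₁ H.part₁-nonempty , trans (cong (G.part₂ _ ∨_) (proj₂ H.part₁-nonempty)) (∨-zeroʳ (G.part₂ _))
  where
  module G = SplitMinterm sg
  module H = SplitMinterm sh
  P₁ P₂ : Point n
  P₁ = G.part₁ ⊔ H.part₂
  P₂ = G.part₂ ⊔ H.part₁
  raise-⊔ : ∀ {p q} → p ⊑ A → q ⊑ B →
            ∀ x → g (raise p x) ∧ h (raise q x) ≡ g (raise (p ⊔ q) x) ∧ h (raise (p ⊔ q) x)
  raise-⊔ {p} {q} p⊑A q⊑B x = cong₂ _∧_
    (dependsOn-raise G.dependsOn-A (λ i Ai → sym (⊔-on-left {p = p} q⊑B A#B i Ai)) x)
    (dependsOn-raise H.dependsOn-A (λ i Bi → sym (⊔-on-right {q = q} p⊑A A#B i Bi)) x)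
  P₁#P₂ : Disjoint P₁ P₂
  P₁#P₂ i e with ∨≡true⇒ (G.part₁ i) (H.part₂ i) e
  ... | inj₁ a rewrite G.parts-disjoint i a
                     | ⊑-disjoint⇒false {q = H.part₁} H.part₁⊑A A#B i (G.part₁⊑A i a) = refl
  ... | inj₂ b rewrite ⊑-disjoint⇒false {q = G.part₂} G.part₂⊑A (disjoint-sym A#B) i (H.part₂⊑A i b)
                     | contraposeᵇ (H.parts-disjoint i) b = refl

-- A minterm of g is one of g ∨ h, and (g ∨ h)_{p=1} = g_{p=1} ∨ h.  Additivity of ds
-- needs g_{p=1}(0) = false for both parts, which is why p₂ must be nonempty.
∨-SplitMintermˡ : ∀ {g h : BoolFun n} {A B b} → Disjoint A B → h 0ₚ ≡ false →
                  ProperSplitMinterm g A → DsCertificate h B b → ProperSplitMinterm (λ x → g x ∨ h x) (A ⊔ B)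
∨-SplitMintermˡ {g = g} {h} {A} {B} {b} A#B h0 (s , p₂-nonempty) Ch = record
  { part₁ = part₁ ; part₂ = part₂ ; parts-disjoint = parts-disjoint
  ; minimal = ∨-minimalTrueˡ H.dependsOn-A A#B h0 minimal (⊔-lub part₁⊑A part₂⊑A)
  ; part₁-nonempty = part₁-nonempty
  ; part₁⊑A = ⊑-⊔ˡ {B = B} part₁⊑A ; part₂⊑A = ⊑-⊔ˡ {B = B} part₂⊑A
  ; ds = ds + b
  ; certificate = ∨-DsCertificate A#B (false-at-0ₚ s) h0 certificate Ch
  ; certificate₁ = DsCertificate-resp (raise-h part₁⊑A)
      (∨-DsCertificate A#B (false-at-part₁ s p₂-nonempty) h0 certificate₁ Ch)
  ; certificate₂ = DsCertificate-resp (raise-h part₂⊑A)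
      (∨-DsCertificate A#B (false-at-part₂ s) h0 certificate₂ Ch)
  } , p₂-nonempty
  where
  open SplitMinterm s
  module H = DsCertificate Ch
  raise-h : ∀ {p} → p ⊑ A → ∀ x → g (raise p x) ∨ h x ≡ g (raise p x) ∨ h (raise p x)
  raise-h p⊑A x = cong (g _ ∨_) (dependsOn-raise H.dependsOn-A (λ i Bi → sym (⊑-disjoint⇒false p⊑A (disjoint-sym A#B) i Bi)) x)

∨-SplitMintermʳ : ∀ {g h : BoolFun n} {A B a} → Disjoint A B → g 0ₚ ≡ false →
                  DsCertificate g A a → ProperSplitMinterm h B → ProperSplitMinterm (λ x → g x ∨ h x) (A ⊔ B)
∨-SplitMintermʳ {g = g} {h} {A} {B} {a} A#B g0 Cg (s , p₂-nonempty) = record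
  { part₁ = part₁ ; part₂ = part₂ ; parts-disjoint = parts-disjoint
  ; minimal = ∨-minimalTrueʳ G.dependsOn-A A#B g0 minimal (⊔-lub part₁⊑A part₂⊑A)
  ; part₁-nonempty = part₁-nonempty
  ; part₁⊑A = ⊑-⊔ʳ {A = A} part₁⊑A ; part₂⊑A = ⊑-⊔ʳ {A = A} part₂⊑A
  ; ds = a + ds
  ; certificate = ∨-DsCertificate A#B g0 (false-at-0ₚ s) Cg certificate
  ; certificate₁ = DsCertificate-resp (raise-g part₁⊑A)
      (∨-DsCertificate A#B g0 (false-at-part₁ s p₂-nonempty) Cg certificate₁)
  ; certificate₂ = DsCertificate-resp (raise-g part₂⊑A)
      (∨-DsCertificate A#B g0 (false-at-part₂ s) Cg certificate₂)
  } , p₂-nonempty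
  where
  open SplitMinterm s
  module G = DsCertificate Cg
  raise-g : ∀ {p} → p ⊑ B → ∀ x → g x ∨ h (raise p x) ≡ g (raise p x) ∨ h (raise p x)
  raise-g p⊑B x = cong (_∨ h _) (dependsOn-raise G.dependsOn-A (λ i Ai → sym (⊑-disjoint⇒false p⊑B A#B i Ai)) x)

-- Read-once formulas

Unique-++⁻ : ∀ (xs : List (Fin n)) {ys} → Unique (xs ++ ys) →
             Unique xs × Unique ys × (∀ {j} → j ∈ xs → j ∈ ys → ⊥)
Unique-++⁻ [] u = [] , u , λ ()
Unique-++⁻ (x ∷ xs) (x∉ ∷ u) with Unique-++⁻ xs u
... | uxs , uys , disj = ++⁻ˡ xs x∉ ∷ uxs , uys , λ { (here refl) j∈ys → All.lookup (++⁻ʳ xs x∉) j∈ys refl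
                                                   ; (there j∈xs) → disj j∈xs }

support : MFormula n → Point n
support (var i)    = only i
support (and′ F G) = support F ⊔ support G
support (or′ F G)  = support F ⊔ support G

support⇒∈vars : (F : MFormula n) (j : Fin n) → support F j ≡ true → j ∈ vars F
support⇒∈vars (var i)    j e = here (sym (only-true⇒≡ i j e))
support⇒∈vars (and′ F G) j e =
  [ (λ Fj → ∈-++⁺ˡ (support⇒∈vars F j Fj)) , (λ Gj → ∈-++⁺ʳ (vars F) (support⇒∈vars G j Gj)) ]′ (∨≡true⇒ _ _ e)
support⇒∈vars (or′ F G)  j e =
  [ (λ Fj → ∈-++⁺ˡ (support⇒∈vars F j Fj)) , (λ Gj → ∈-++⁺ʳ (vars F) (support⇒∈vars G j Gj)) ]′ (∨≡true⇒ _ _ e)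

readOnce-++⁻ : (F G : MFormula n) → Unique (vars F ++ vars G) → ReadOnce F × ReadOnce G × Disjoint (support F) (support G)
readOnce-++⁻ F G u with Unique-++⁻ (vars F) u
... | uF , uG , disj = uF , uG , support-disjoint
  where
  support-disjoint : Disjoint (support F) (support G)
  support-disjoint j Fj with support G j in Gj
  ... | false = refl
  ... | true  = ⊥-elim (disj (support⇒∈vars F j Fj) (support⇒∈vars G j Gj))

evalF-dependsOn-support : (F : MFormula n) → DependsOn (evalF F) (support F)
evalF-dependsOn-support (var i)    x y e = e i (only-self i)
evalF-dependsOn-support (and′ F G) = dependsOn-∧ (evalF-dependsOn-support F) (evalF-dependsOn-support G)
evalF-dependsOn-support (or′ F G)  = dependsOn-∨ (evalF-dependsOn-support F) (evalF-dependsOn-support G)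

evalF-0ₚ : (F : MFormula n) → evalF F 0ₚ ≡ false
evalF-0ₚ (var i) = refl
evalF-0ₚ (and′ F G) rewrite evalF-0ₚ F = refl
evalF-0ₚ (or′ F G)  rewrite evalF-0ₚ F | evalF-0ₚ G = refl

evalF-monotone : (F : MFormula n) → Monotone (evalF F)
evalF-monotone (var i) x⊑y e = x⊑y i e
evalF-monotone (and′ F G) {x} x⊑y e with ∧≡true⇒ (evalF F x) _ e
... | Fx , Gx rewrite evalF-monotone F x⊑y Fx | evalF-monotone G x⊑y Gx = refl
evalF-monotone (or′ F G) {x} {y} x⊑y e with ∨≡true⇒ (evalF F x) _ e
... | inj₁ Fx rewrite evalF-monotone F x⊑y Fx = refl
... | inj₂ Gx rewrite evalF-monotone G x⊑y Gx = ∨-zeroʳ (evalF F y)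

dsCertificate : (F : MFormula n) → ReadOnce F → Σ ℕ (DsCertificate (evalF F) (support F))
dsCertificate (var i) _ = 1 , var-DsCertificate i
dsCertificate (and′ F G) ro with readOnce-++⁻ F G ro
... | roF , roG , F#G = _ , ∧-DsCertificate F#G (proj₂ (dsCertificate F roF)) (proj₂ (dsCertificate G roG))
dsCertificate (or′ F G) ro with readOnce-++⁻ F G ro
... | roF , roG , F#G =
  _ , ∨-DsCertificate F#G (evalF-0ₚ F) (evalF-0ₚ G) (proj₂ (dsCertificate F roF)) (proj₂ (dsCertificate G roG))

dual : MFormula n → MFormula n
dual (var i)    = var i
dual (and′ F G) = or′ (dual F) (dual G)
dual (or′ F G)  = and′ (dual F) (dual G)

vars-dual : (F : MFormula n) → vars (dual F) ≡ vars F
vars-dual (var i)    = refl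
vars-dual (and′ F G) = cong₂ _++_ (vars-dual F) (vars-dual G)
vars-dual (or′ F G)  = cong₂ _++_ (vars-dual F) (vars-dual G)

readOnce-dual : (F : MFormula n) → ReadOnce F → ReadOnce (dual F)
readOnce-dual F = subst Unique (sym (vars-dual F))

negate : Point n → Point n
negate x i = not (x i)

evalF-dual : (F : MFormula n) (x : Point n) → evalF (dual F) x ≡ not (evalF F (negate x))
evalF-dual (var i) x = sym (not-involutive (x i))
evalF-dual (and′ F G) x rewrite evalF-dual F x | evalF-dual G x = sym (deMorgan₁ (evalF F (negate x)) (evalF G (negate x)))
evalF-dual (or′ F G)  x rewrite evalF-dual F x | evalF-dual G x = sym (deMorgan₂ (evalF F (negate x)) (evalF G (negate x)))

Split ProperSplit : MFormula n → Set
Split F       = SplitMinterm (evalF F) (support F)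
ProperSplit F = ProperSplitMinterm (evalF F) (support F)

-- The two induction hypotheses: what a subformula must supply when it occurs
-- below an AND gate, resp. below an OR gate.
ConjunctReady DisjunctReady : MFormula n → Set
ConjunctReady F = ProperSplit (dual F) ⊎ Split F
DisjunctReady F = ProperSplit F ⊎ Split (dual F)

∧-properSplit : (g h : MFormula n) → ReadOnce (and′ g h) → ConjunctReady g → ConjunctReady h →
                ProperSplit (and′ g h) ⊎ ProperSplit (dual (and′ g h))
∧-properSplit g h ro rg rh with readOnce-++⁻ (dual g) (dual h) (readOnce-dual (and′ g h) ro)
... | rodg , rodh , dg#dh with rg | rh
... | inj₁ sdg | _ = inj₂ (∨-SplitMintermˡ dg#dh (evalF-0ₚ (dual h)) sdg (proj₂ (dsCertificate (dual h) rodh)))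
... | inj₂ _ | inj₁ sdh = inj₂ (∨-SplitMintermʳ dg#dh (evalF-0ₚ (dual g)) (proj₂ (dsCertificate (dual g) rodg)) sdh)
... | inj₂ sg | inj₂ sh = inj₁ (∧-SplitMinterm (proj₂ (proj₂ (readOnce-++⁻ g h ro))) sg sh)

∨-properSplit : (g h : MFormula n) → ReadOnce (or′ g h) → DisjunctReady g → DisjunctReady h →
                ProperSplit (or′ g h) ⊎ ProperSplit (dual (or′ g h))
∨-properSplit g h ro rg rh with readOnce-++⁻ g h ro
... | rog , roh , g#h with rg | rh
... | inj₁ sg | _ = inj₁ (∨-SplitMintermˡ g#h (evalF-0ₚ h) sg (proj₂ (dsCertificate h roh)))
... | inj₂ _ | inj₁ sh = inj₁ (∨-SplitMintermʳ g#h (evalF-0ₚ g) (proj₂ (dsCertificate g rog)) sh)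
... | inj₂ sdg | inj₂ sdh =
  inj₂ (∧-SplitMinterm (proj₂ (proj₂ (readOnce-++⁻ (dual g) (dual h) (readOnce-dual (or′ g h) ro)))) sdg sdh)

properSplit⇒ready : (F : MFormula n) → ProperSplit F ⊎ ProperSplit (dual F) → ConjunctReady F × DisjunctReady F
properSplit⇒ready F (inj₁ s) = inj₂ (proj₁ s) , inj₁ s
properSplit⇒ready F (inj₂ s) = inj₁ s , inj₂ (proj₁ s)

ready : (F : MFormula n) → ReadOnce F → ConjunctReady F × DisjunctReady F
ready (var i)    _  = inj₂ (var-SplitMinterm i) , inj₂ (var-SplitMinterm i)
ready (and′ g h) ro with readOnce-++⁻ g h ro
... | rog , roh , _ = properSplit⇒ready (and′ g h) (∧-properSplit g h ro (proj₁ (ready g rog)) (proj₁ (ready h roh)))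
ready (or′ g h)  ro with readOnce-++⁻ g h ro
... | rog , roh , _ = properSplit⇒ready (or′ g h) (∨-properSplit g h ro (proj₂ (ready g rog)) (proj₂ (ready h roh)))

properSplit : (F : MFormula n) → ReadOnce F → 2 ≤ length (vars F) → ProperSplit F ⊎ ProperSplit (dual F)
properSplit (var i) _ (s≤s ())
properSplit (and′ g h) ro _ with readOnce-++⁻ g h ro
... | rog , roh , _ = ∧-properSplit g h ro (proj₁ (ready g rog)) (proj₁ (ready h roh))
properSplit (or′ g h)  ro _ with readOnce-++⁻ g h ro
... | rog , roh , _ = ∨-properSplit g h ro (proj₂ (ready g rog)) (proj₂ (ready h roh))

-- Duality

foldr-∧-not : ∀ {A : Set} (h k : A → Bool) → (∀ a → h a ≡ not (k a)) →
              ∀ as → foldr (λ a acc → h a ∧ acc) true as ≡ not (foldr (λ a acc → k a ∨ acc) false as)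
foldr-∧-not h k h≡¬k []       = refl
foldr-∧-not h k h≡¬k (a ∷ as) rewrite h≡¬k a | foldr-∧-not h k h≡¬k as = sym (deMorgan₂ (k a) _)

foldr-∨-not : ∀ {A : Set} (h k : A → Bool) → (∀ a → h a ≡ not (k a)) →
              ∀ as → foldr (λ a acc → h a ∨ acc) false as ≡ not (foldr (λ a acc → k a ∧ acc) true as)
foldr-∨-not h k h≡¬k []       = refl
foldr-∨-not h k h≡¬k (a ∷ as) rewrite h≡¬k a | foldr-∨-not h k h≡¬k as = sym (deMorgan₁ (k a) _)

evalLit-negate : (l : Literal n) (x : Point n) → evalLit l x ≡ not (evalLit l (negate x))
evalLit-negate (i , true)  x = sym (not-involutive (x i))
evalLit-negate (i , false) x = sym (not-involutive (not (x i)))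

evalDNF-dual : (D : DNF n) (x : Point n) → evalDNF D x ≡ not (evalCNF D (negate x))
evalDNF-dual D x = foldr-∨-not _ (λ t → foldr (λ l a → evalLit l (negate x) ∨ a) false t)
  (foldr-∧-not _ _ (λ l → evalLit-negate l x)) D

evalCNF-dual : (C : CNF n) (x : Point n) → evalCNF C x ≡ not (evalDNF C (negate x))
evalCNF-dual C x = foldr-∧-not _ (λ c → foldr (λ l a → evalLit l (negate x) ∧ a) true c)
  (foldr-∨-not _ _ (λ l → evalLit-negate l x)) C

not≡true⇒ : ∀ {b} → not b ≡ true → b ≡ false
not≡true⇒ {false} _ = refl

negate-set1 : (T : Subset n) (x : Point n) (i : Fin n) → negate (set1 T x) i ≡ set0 T (negate x) i
negate-set1 T x i with lookup T i
... | true  = refl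
... | false = refl

module Duality {f g : BoolFun n} (f-ext : Extensional f) (g-dual : ∀ x → g x ≡ not (f (negate x))) where
  open ≡-Reasoning

  restrict-dual : ∀ T x → restrict1 g T x ≡ not (restrict0 f T (negate x))
  restrict-dual T x = trans (g-dual (set1 T x)) (cong not (f-ext (negate-set1 T x)))

  restrict0-ext : ∀ T → Extensional (restrict0 f T)
  restrict0-ext T x≗y = f-ext (λ i → cong (if lookup T i then false else_) (x≗y i))

  isDS⇒isCS : ∀ {k} → IsDS g k → IsCS f k
  isDS⇒isCS {k} ((D , D-correct , length-D) , D-minimum) = (D , D-correct-CNF , length-D) , C-bound
    where
    D-correct-CNF : CNFfor f D
    D-correct-CNF x = begin
      evalCNF D x                          ≡⟨ evalCNF-dual D x ⟩
      not (evalDNF D (negate x))           ≡⟨ cong not (trans (D-correct (negate x)) (g-dual (negate x))) ⟩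
      not (not (f (negate (negate x))))    ≡⟨ not-involutive _ ⟩
      f (negate (negate x))                ≡⟨ f-ext (λ i → not-involutive (x i)) ⟩
      f x                                  ∎
    C-bound : ∀ C → CNFfor f C → k ≤ length C
    C-bound C C-correct = D-minimum C λ x → begin
      evalDNF C x                ≡⟨ evalDNF-dual C x ⟩
      not (evalCNF C (negate x)) ≡⟨ cong not (C-correct (negate x)) ⟩
      not (f (negate x))         ≡⟨ g-dual x ⟨
      g x                        ∎

  isMinterm⇒isMaxterm : ∀ {S} → IsMinterm g S → IsMaxterm f S
  isMinterm⇒isMaxterm {S} (forces1 , minimal) = forces0 , λ S′ S′⊂S forces0′ → minimal S′ S′⊂S (λ x →
    trans (restrict-dual S′ x) (cong not (forces0′ (negate x))))
    where
    forces0 : Forces0 f S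
    forces0 y = trans (restrict0-ext S (λ i → sym (not-involutive (y i))))
      (not≡true⇒ (trans (sym (restrict-dual S (negate y))) (forces1 (negate y))))

MintermSplitting : BoolFun n → Set
MintermSplitting f = ∃ λ S → ∃₂ λ S₁ S₂ → IsMinterm f S × IsPartition2 S S₁ S₂ ×
  ∃ λ k → IsDS f k × IsDS (restrict1 f S₁) k × IsDS (restrict1 f S₂) k

MaxtermSplitting : BoolFun n → Set
MaxtermSplitting f = ∃ λ T → ∃₂ λ T₁ T₂ → IsMaxterm f T × IsPartition2 T T₁ T₂ ×
  ∃ λ k → IsCS f k × IsCS (restrict0 f T₁) k × IsCS (restrict0 f T₂) k

mintermSplitting-dual : ∀ {f g : BoolFun n} → Extensional f → (∀ x → g x ≡ not (f (negate x))) →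
                        MintermSplitting g → MaxtermSplitting f
mintermSplitting-dual {f = f} {g} f-ext g-dual (S , S₁ , S₂ , minterm , partition , k , ds , ds₁ , ds₂) =
  S , S₁ , S₂ , isMinterm⇒isMaxterm minterm , partition , k , isDS⇒isCS ds , restricted S₁ ds₁ , restricted S₂ ds₂
  where
  open Duality f-ext g-dual
  restricted : ∀ T {k} → IsDS (restrict1 g T) k → IsCS (restrict0 f T) k
  restricted T = Duality.isDS⇒isCS (restrict0-ext T) (restrict-dual T)

∈-tabulate : ∀ {p : Point n} {i} → p i ≡ true → i ∈ₛ tabulate p
∈-tabulate {p = p} {i} pi = lookup⇒[]= i _ (trans (lookup∘tabulate p i) pi)

lookup-tabulate-∪ : (p q : Point n) (i : Fin n) → lookup (tabulate p ∪ tabulate q) i ≡ (p ⊔ q) i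
lookup-tabulate-∪ p q i =
  trans (lookup-zipWith _∨_ i (tabulate p) (tabulate q)) (cong₂ _∨_ (lookup∘tabulate p i) (lookup∘tabulate q i))

lookup-tabulate-∩ : (p q : Point n) (i : Fin n) → lookup (tabulate p ∩ tabulate q) i ≡ p i ∧ q i
lookup-tabulate-∩ p q i =
  trans (lookup-zipWith _∧_ i (tabulate p) (tabulate q)) (cong₂ _∧_ (lookup∘tabulate p i) (lookup∘tabulate q i))

set1-0ₚ-true⇒ : (T : Subset n) (i : Fin n) → set1 T 0ₚ i ≡ true → lookup T i ≡ true
set1-0ₚ-true⇒ T i e with lookup T i
... | true = refl

properSplit⇒mintermSplitting : ∀ {f : BoolFun n} {A} → Monotone f → ProperSplitMinterm f A → MintermSplitting f
properSplit⇒mintermSplitting {n = n} {f} {A} mono (s , j , p₂j) =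
  S , S₁ , S₂ , (forces1 , minimal′) ,
  (refl , S₁∩S₂-empty , (_ , ∈-tabulate (proj₂ part₁-nonempty)) , (j , ∈-tabulate p₂j)) ,
  ds , isDS certificate , isDS (restricted part₁ certificate₁) , isDS (restricted part₂ certificate₂)
  where
  open SplitMinterm s
  S₁ S₂ S : Subset n
  S₁ = tabulate part₁
  S₂ = tabulate part₂
  S  = S₁ ∪ S₂
  forces1 : Forces1 f S
  forces1 x = mono (λ i pi → cong (λ b → if b then true else x i) (trans (lookup-tabulate-∪ part₁ part₂ i) pi))
                   (proj₁ minimal)
  minimal′ : ∀ S′ → S′ ⊂ S → ¬ Forces1 f S′
  minimal′ S′ (S′⊆S , w , w∈S , w∉S′) forces1′ =
    w∉S′ (lookup⇒[]= w S′ (set1-0ₚ-true⇒ S′ w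
      (p⊑q w (trans (sym (lookup-tabulate-∪ part₁ part₂ w)) ([]=⇒lookup w∈S)))))
    where
    q⊑p : set1 S′ 0ₚ ⊑ part₁ ⊔ part₂
    q⊑p i qi = trans (sym (lookup-tabulate-∪ part₁ part₂ i))
                     ([]=⇒lookup (S′⊆S (lookup⇒[]= i S′ (set1-0ₚ-true⇒ S′ i qi))))
    p⊑q : part₁ ⊔ part₂ ⊑ set1 S′ 0ₚ
    p⊑q = proj₂ minimal _ q⊑p (forces1′ 0ₚ)
  S₁∩S₂-empty : Empty (S₁ ∩ S₂)
  S₁∩S₂-empty (i , i∈S₁∩S₂)
    with ∧≡true⇒ (part₁ i) (part₂ i) (trans (sym (lookup-tabulate-∩ part₁ part₂ i)) ([]=⇒lookup i∈S₁∩S₂))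
  ... | p₁i , p₂i = true≢false p₂i (parts-disjoint i p₁i)
  restricted : ∀ p {k} → DsCertificate (λ x → f (raise p x)) A k → DsCertificate (restrict1 f (tabulate p)) A k
  restricted p = DsCertificate-resp λ x →
    dependsOn⇒extensional dependsOn-A (λ i → cong (λ b → if b then true else x i) (sym (lookup∘tabulate p i)))

lemma3 : (n : ℕ) (F : MFormula n) → ReadOnce F → 2 ≤ length (vars F) →
    (∃ λ T → ∃₂ λ T₁ T₂ → IsMaxterm (evalF F) T × IsPartition2 T T₁ T₂ ×
       ∃ λ k → IsCS (evalF F) k × IsCS (restrict0 (evalF F) T₁) k × IsCS (restrict0 (evalF F) T₂) k)
    ⊎
    (∃ λ S → ∃₂ λ S₁ S₂ → IsMinterm (evalF F) S × IsPartition2 S S₁ S₂ ×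
       ∃ λ k → IsDS (evalF F) k × IsDS (restrict1 (evalF F) S₁) k × IsDS (restrict1 (evalF F) S₂) k)
lemma3 n F ro two-vars with properSplit F ro two-vars
... | inj₁ split      = inj₂ (properSplit⇒mintermSplitting (evalF-monotone F) split)
... | inj₂ dual-split = inj₁ (mintermSplitting-dual (dependsOn⇒extensional (evalF-dependsOn-support F)) (evalF-dual F)
                               (properSplit⇒mintermSplitting (evalF-monotone (dual F)) dual-split))
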